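{- Let $\mathscr{P}_1$ and $\mathscr{P}_2$ be positions of (possibly different) finite impartial games played under the normal play convention, and let $T$ be a solution tree for the sum $\mathscr{P}_1+\mathscr{P}_2$. Let $D(T)$ denote the abstract rooted tree underlying $T$ in which each node is labelled only by its outcome (W or L) and each edge is labelled only by the index $j\in\{1,2\}$ of the component in which the corresponding move is made (so $D(T)$ forgets the actual positions). Then there is a function $F$, defined on such labelled trees and taking values in $\{1,2\}\times\mathbb{N}$, which does not depend on the games, the positions or $T$, such that for every such $\mathscr{P}_1,\mathscr{P}_2$ and every solution tree $T$ of $\mathscr{P}_1+\mathscr{P}_2$, writing $F(D(T))=(i,m)$, the nimber of $\mathscr{P}_i$ equals $m$. Moreover, the nimbers of $\mathscr{P}_1$ and $\mathscr{P}_2$ are equal if the root of $D(T)$ is labelled L and different if it is labelled W. In other words, from a solution tree of $\mathscr{P}_1+\mathscr{P}_2$ alone, without examining any other position, one can determine the nimber of one of the two components and whether the nimber of the other component is equal to it or different.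
   Context: An impartial game: a set of positions, each position $\mathscr{Q}$ having a set of options (positions reachable in one move, the same for both players); the game is finite, i.e. every sequence of successive moves terminates. Under the normal play convention, the player who cannot move loses. A position is winning (outcome W) if the player to move has a winning strategy and losing (outcome L) otherwise; equivalently, a position is W iff it has at least one option with outcome L, and terminal positions are L. The sum $\mathscr{Q}_1+\mathscr{Q}_2$ of two positions is the position whose options are the positions $\mathscr{Q}_1'+\mathscr{Q}_2$ with $\mathscr{Q}_1'$ an option of $\mathscr{Q}_1$ and $\mathscr{Q}_1+\mathscr{Q}_2'$ with $\mathscr{Q}_2'$ an option of $\mathscr{Q}_2$ (a move is made in exactly one component). The nimber (Sprague–Grundy value) $g(\mathscr{Q})$ of a position is defined recursively as the least non-negative integer not belonging to $\{g(\mathscr{Q}') : \mathscr{Q}' \text{ an option of } \mathscr{Q}\}$ (so terminal positions have nimber $0$). A solution tree for a position $\mathscr{R}$ is a finite rooted tree whose nodes are positions, with root $\mathscr{R}$, in which every child of a node is an option of that node, each node is labelled with its true outcome, and: every node with outcome L has as children exactly all of its options (one child per option), while every node with outcome W has at least one child, at least one of which has outcome L. -}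

module Defs where

open import Data.Nat using (ℕ; zero; suc)
open import Data.Nat.Properties using (_≟_)
open import Data.List using (List; []; _∷_; map; _++_; length)
open import Data.List.Membership.Propositional using (_∈_; mapWith∈)
open import Data.List.Membership.Propositional.Properties using (∈-++⁻; ∈-map⁻)
open import Data.List.Membership.DecPropositional _≟_ using (_∈?_)
open import Data.List.Relation.Unary.All using (All)
open import Data.List.Relation.Unary.Any using (Any)
open import Data.List.Relation.Unary.Unique.Propositional using (Unique)
open import Data.Product using (Σ; _×_; _,_; proj₁; proj₂)
open import Data.Sum using (inj₁; inj₂)
open import Induction.WellFounded using (WellFounded; Acc; acc)
open import Relation.Binary.PropositionalEquality using (_≡_; refl)
open import Relation.Nullary using (yes; no)

record Game : Set₁ where
  field
    Pos  : Set
    opts : Pos → List Pos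
    wf   : WellFounded (λ q p → q ∈ opts p)
open Game public

IsOption : (G : Game) → Pos G → Pos G → Set
IsOption G q p = q ∈ opts G p

-- Outcomes (normal play): W iff some option is L; terminal positions are L.

data Outcome : Set where
  W L : Outcome

outcomeFromOptions : List Outcome → Outcome
outcomeFromOptions []       = L
outcomeFromOptions (L ∷ os) = W
outcomeFromOptions (W ∷ os) = outcomeFromOptions os

outcomeAcc : (G : Game) (p : Pos G) → Acc (IsOption G) p → Outcome
outcomeAcc G p (acc rs) =
  outcomeFromOptions (mapWith∈ (opts G p) (λ {q} q∈ → outcomeAcc G q (rs q∈)))

outcome : (G : Game) → Pos G → Outcome
outcome G p = outcomeAcc G p (wf G p)

mexFrom : ℕ → ℕ → List ℕ → ℕ
mexFrom zero    n xs = n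
mexFrom (suc f) n xs with n ∈? xs
... | yes _ = mexFrom f (suc n) xs
... | no  _ = n

-- least non-negative integer not in the list (it is ≤ length xs)
mex : List ℕ → ℕ
mex xs = mexFrom (suc (length xs)) 0 xs

nimberAcc : (G : Game) (p : Pos G) → Acc (IsOption G) p → ℕ
nimberAcc G p (acc rs) =
  mex (mapWith∈ (opts G p) (λ {q} q∈ → nimberAcc G q (rs q∈)))

nimber : (G : Game) → Pos G → ℕ
nimber G p = nimberAcc G p (wf G p)

sumOpts : (G₁ G₂ : Game) → Pos G₁ × Pos G₂ → List (Pos G₁ × Pos G₂)
sumOpts G₁ G₂ (a , b) =
  map (λ a′ → (a′ , b)) (opts G₁ a) ++ map (λ b′ → (a , b′)) (opts G₂ b)

sumAcc : (G₁ G₂ : Game) {a : Pos G₁} {b : Pos G₂} →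
         Acc (IsOption G₁) a → Acc (IsOption G₂) b →
         Acc (λ q p → q ∈ sumOpts G₁ G₂ p) (a , b)
sumAcc G₁ G₂ {a} {b} (acc ra) (acc rb) = acc step
  where
  step : ∀ {y} → y ∈ sumOpts G₁ G₂ (a , b) →
         Acc (λ q p → q ∈ sumOpts G₁ G₂ p) y
  step y∈ with ∈-++⁻ (map (λ a′ → (a′ , b)) (opts G₁ a)) y∈
  ... | inj₁ m with ∈-map⁻ (λ a′ → (a′ , b)) m
  ...   | a′ , a′∈ , refl = sumAcc G₁ G₂ (ra a′∈) (acc rb)
  step y∈ | inj₂ m with ∈-map⁻ (λ b′ → (a , b′)) m
  ...   | b′ , b′∈ , refl = sumAcc G₁ G₂ (acc ra) (rb b′∈)

_⊕_ : Game → Game → Game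
G₁ ⊕ G₂ = record
  { Pos  = Pos G₁ × Pos G₂
  ; opts = sumOpts G₁ G₂
  ; wf   = λ { (a , b) → sumAcc G₁ G₂ (wf G₁ a) (wf G₂ b) }
  }

data Comp : Set where
  one two : Comp

nimberAt : (G₁ G₂ : Game) → Comp → Pos G₁ → Pos G₂ → ℕ
nimberAt G₁ G₂ one p₁ p₂ = nimber G₁ p₁
nimberAt G₁ G₂ two p₁ p₂ = nimber G₂ p₂

data LTree : Set where
  lnode : Outcome → List (Comp × LTree) → LTree

lrootLabel : LTree → Outcome
lrootLabel (lnode o _) = o

-- Each node is a position of the sum together with its outcome label;
-- each edge additionally records the component in which the move is
-- made (this is determined by the two positions, see Step).

module _ (G₁ G₂ : Game) where

  Step : Comp → Pos G₁ × Pos G₂ → Pos G₁ × Pos G₂ → Set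
  Step one (a , b) (a′ , b′) = (a′ ∈ opts G₁ a) × (b′ ≡ b)
  Step two (a , b) (a′ , b′) = (a′ ≡ a) × (b′ ∈ opts G₂ b)

  data SumTree : Set where
    node : Pos G₁ × Pos G₂ → Outcome → List (Comp × SumTree) → SumTree

  rootPos : SumTree → Pos G₁ × Pos G₂
  rootPos (node p _ _) = p

  rootLabel : SumTree → Outcome
  rootLabel (node _ o _) = o

  childPositions : List (Comp × SumTree) → List (Pos G₁ × Pos G₂)
  childPositions cs = map (λ c → rootPos (proj₂ c)) cs

  data IsSolutionTree : SumTree → Set where
    sol : ∀ {p o cs} →
          o ≡ outcome (G₁ ⊕ G₂) p →
          All (λ c → Step (proj₁ c) p (rootPos (proj₂ c)) ×
                     IsSolutionTree (proj₂ c)) cs →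
          (o ≡ L → Unique (childPositions cs) ×
                   (∀ q → q ∈ opts (G₁ ⊕ G₂) p → q ∈ childPositions cs)) →
          (o ≡ W → Any (λ c → rootLabel (proj₂ c) ≡ L) cs) →
          IsSolutionTree (node p o cs)

  mutual
    D : SumTree → LTree
    D (node _ o cs) = lnode o (Dchildren cs)

    Dchildren : List (Comp × SumTree) → List (Comp × LTree)
    Dchildren []             = []
    Dchildren ((j , t) ∷ cs) = (j , D t) ∷ Dchildren cs

-- Sprague–Grundy for sums: P₁ + P₂ is L exactly when g(P₁) = g(P₂).  Below a W node there is an L child P₁′ + P₂′
-- whose F-value (i , m) gives g(P₁′) = g(P₂′) = m; the move changed only
-- one component, so the other one, unchanged from the root, has nimber m.
-- Below an L node all options occur as children.  A child P₁′ + P₂ that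
-- reports component 2 gives g(P₂) outright; if every such child reports
-- component 1, the values seen are exactly the nimbers of all options of
-- P₁, and their mex is g(P₁).
module Submission where

open import Defs
open import Data.Nat using (ℕ; zero; suc; _+_; _≤_; _<_; z≤n)
open import Data.Nat.Properties
  using (_≟_; <-cmp; +-suc; +-identityʳ; ≤⇒≯; m≤n⇒m<n∨m≡n; n<1+n)
open import Data.Fin using (Fin; toℕ)
open import Data.Fin.Properties using (toℕ<n; toℕ-injective; <⇒notInjective)
open import Data.Product using (Σ; _×_; _,_; proj₁; proj₂)
open import Data.Sum using (_⊎_; inj₁; inj₂)
import Data.Sum as Sum
open import Data.Empty using (⊥-elim)
open import Data.List using (List; []; _∷_; map; length; lookup)
open import Data.List.Membership.Propositional using (_∈_; _∉_; mapWith∈)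
open import Data.List.Membership.Propositional.Properties
  using (mapWith∈-cong; mapWith∈≗map; ∈-map⁺; ∈-map⁻; ∈-++⁺ˡ; ∈-++⁺ʳ; ∈-++⁻)
open import Data.List.Membership.DecPropositional _≟_ using (_∈?_)
open import Data.List.Relation.Binary.Subset.Propositional using (_⊆_)
open import Data.List.Relation.Unary.All using (All; []; _∷_; tabulate)
open import Data.List.Relation.Unary.All.Properties using (map⁺)
open import Data.List.Relation.Unary.Any using (Any; here; there; index)
open import Data.List.Relation.Unary.Any.Properties using (lookup-index)
open import Induction.WellFounded using (Acc; acc; acc⇒asym)
open import Relation.Binary.PropositionalEquality
  using (_≡_; _≢_; refl; sym; trans; cong; subst; module ≡-Reasoning)
open import Relation.Binary.Definitions using (tri<; tri≈; tri>)
open import Relation.Nullary using (¬_; yes; no)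

open ≡-Reasoning

mexFrom-skips : ∀ fuel n xs k → n ≤ k → k < mexFrom fuel n xs → k ∈ xs
mexFrom-skips zero    n xs k n≤k k<n = ⊥-elim (≤⇒≯ n≤k k<n)
mexFrom-skips (suc f) n xs k n≤k k<r with n ∈? xs
... | no  _  = ⊥-elim (≤⇒≯ n≤k k<r)
... | yes n∈ with m≤n⇒m<n∨m≡n n≤k
...   | inj₁ n<k  = mexFrom-skips f (suc n) xs k n<k k<r
...   | inj₂ refl = n∈

mexFrom-∉-or-exhausted : ∀ fuel n xs →
  mexFrom fuel n xs ∉ xs ⊎ mexFrom fuel n xs ≡ fuel + n
mexFrom-∉-or-exhausted zero    n xs = inj₂ refl
mexFrom-∉-or-exhausted (suc f) n xs with n ∈? xs
... | no  n∉ = inj₁ n∉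
... | yes _  = Sum.map₂ (λ e → trans e (+-suc f n)) (mexFrom-∉-or-exhausted f (suc n) xs)

-- Pigeonhole, via the positions at which 0, 1, …, length xs occur.
¬⊇upTo-suc-length : ∀ xs → ¬ (∀ k → k < suc (length xs) → k ∈ xs)
¬⊇upTo-suc-length xs covers = <⇒notInjective (n<1+n (length xs)) position-injective
  where
  position : Fin (suc (length xs)) → Fin (length xs)
  position i = index (covers (toℕ i) (toℕ<n i))
  position-injective : ∀ {i j} → position i ≡ position j → i ≡ j
  position-injective {i} {j} eq = toℕ-injective (begin
    toℕ i                    ≡⟨ lookup-index (covers (toℕ i) (toℕ<n i)) ⟩
    lookup xs (position i)   ≡⟨ cong (lookup xs) eq ⟩
    lookup xs (position j)   ≡⟨ lookup-index (covers (toℕ j) (toℕ<n j)) ⟨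
    toℕ j                    ∎)

<mex⇒∈ : ∀ xs {k} → k < mex xs → k ∈ xs
<mex⇒∈ xs {k} = mexFrom-skips (suc (length xs)) 0 xs k z≤n

mex-∉ : ∀ xs → mex xs ∉ xs
mex-∉ xs with mexFrom-∉-or-exhausted (suc (length xs)) 0 xs
... | inj₁ ∉xs      = ∉xs
... | inj₂ exhausted = ⊥-elim (¬⊇upTo-suc-length xs λ k k< →
  <mex⇒∈ xs (subst (k <_) (sym (trans exhausted (+-identityʳ _))) k<))

mex-cong : ∀ {xs ys} → xs ⊆ ys → ys ⊆ xs → mex xs ≡ mex ys
mex-cong {xs} {ys} xs⊆ys ys⊆xs with <-cmp (mex xs) (mex ys)
... | tri< lt _ _ = ⊥-elim (mex-∉ xs (ys⊆xs (<mex⇒∈ ys lt)))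
... | tri≈ _ eq _ = eq
... | tri> _ _ gt = ⊥-elim (mex-∉ ys (xs⊆ys (<mex⇒∈ xs gt)))

module AccRecursion (G : Game) {A : Set} (combine : List A → A)
  (f : ∀ p → Acc (IsOption G) p → A)
  (f-acc : ∀ p (rs : ∀ {q} → IsOption G q p → Acc (IsOption G) q) → f p (acc rs) ≡ combine (mapWith∈ (opts G p) λ {q} q∈ → f q (rs q∈)))
  where

  f-irrelevant : ∀ p (x y : Acc (IsOption G) p) → f p x ≡ f p y
  f-irrelevant p (acc rs) (acc ss) = begin
    f p (acc rs)                                           ≡⟨ f-acc p rs ⟩
    combine (mapWith∈ (opts G p) λ {q} q∈ → f q (rs q∈))       ≡⟨ cong combine (mapWith∈-cong (opts G p) _ _
                                                                λ q∈ → f-irrelevant _ (rs q∈) (ss q∈)) ⟩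
    combine (mapWith∈ (opts G p) λ {q} q∈ → f q (ss q∈))       ≡⟨ f-acc p ss ⟨
    f p (acc ss)                                           ∎

  f-unfold : ∀ p → f p (wf G p) ≡ combine (map (λ q → f q (wf G q)) (opts G p))
  f-unfold p with wf G p
  ... | acc rs = begin
    f p (acc rs)                                                  ≡⟨ f-acc p rs ⟩
    combine (mapWith∈ (opts G p) λ {q} q∈ → f q (rs q∈))              ≡⟨ cong combine (mapWith∈-cong (opts G p) _ _
                                                                       λ q∈ → f-irrelevant _ (rs q∈) (wf G _)) ⟩
    combine (mapWith∈ (opts G p) λ {q} _ → f q (wf G q))     ≡⟨ cong combine (mapWith∈≗map _ (opts G p)) ⟩
    combine (map (λ q → f q (wf G q)) (opts G p))            ∎

module _ (G : Game) where

  option-irrefl : ∀ {p} → p ∉ opts G p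
  option-irrefl p∈ = acc⇒asym (wf G _) p∈ p∈

  nimber-unfold : ∀ p → nimber G p ≡ mex (map (nimber G) (opts G p))
  nimber-unfold = AccRecursion.f-unfold G mex (nimberAcc G) (λ _ _ → refl)

  nimber-option-≢ : ∀ {p q} → q ∈ opts G p → nimber G q ≢ nimber G p
  nimber-option-≢ {p} q∈ eq = mex-∉ (map (nimber G) (opts G p))
    (subst (_∈ _) (trans eq (nimber-unfold p)) (∈-map⁺ (nimber G) q∈))

  nimber-below : ∀ {p k} → k < nimber G p → Σ (Pos G) λ q → q ∈ opts G p × nimber G q ≡ k
  nimber-below {p} k< with ∈-map⁻ (nimber G)
    (<mex⇒∈ (map (nimber G) (opts G p)) (subst (_ <_) (nimber-unfold p) k<))
  ... | q , q∈ , eq = q , q∈ , sym eq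

  outcome-unfold : ∀ p → outcome G p ≡ outcomeFromOptions (map (outcome G) (opts G p))
  outcome-unfold = AccRecursion.f-unfold G outcomeFromOptions (outcomeAcc G) (λ _ _ → refl)

  outcome-W : ∀ {p q} → q ∈ opts G p → outcome G q ≡ L → outcome G p ≡ W
  outcome-W {p} q∈ q-L = trans (outcome-unfold p)
    (fromOptions-W (subst (_∈ _) q-L (∈-map⁺ (outcome G) q∈)))
    where
    fromOptions-W : ∀ {os} → L ∈ os → outcomeFromOptions os ≡ W
    fromOptions-W {L ∷ _}  _         = refl
    fromOptions-W {W ∷ _}  (there l) = fromOptions-W l

  outcome-L : ∀ {p} → (∀ {q} → q ∈ opts G p → outcome G q ≡ W) → outcome G p ≡ L
  outcome-L {p} all-W = trans (outcome-unfold p) (fromOptions-L (map⁺ (tabulate all-W)))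
    where
    fromOptions-L : ∀ {os} → All (_≡ W) os → outcomeFromOptions os ≡ L
    fromOptions-L []           = refl
    fromOptions-L (refl ∷ ws) = fromOptions-L ws

module _ (G₁ G₂ : Game) where

  move₁ : ∀ {a a′ b} → a′ ∈ opts G₁ a → (a′ , b) ∈ opts (G₁ ⊕ G₂) (a , b)
  move₁ a′∈ = ∈-++⁺ˡ (∈-map⁺ _ a′∈)

  move₂ : ∀ {a b b′} → b′ ∈ opts G₂ b → (a , b′) ∈ opts (G₁ ⊕ G₂) (a , b)
  move₂ {a} b′∈ = ∈-++⁺ʳ (map _ (opts G₁ a)) (∈-map⁺ _ b′∈)

  option⇒Step : ∀ {a b} q → q ∈ opts (G₁ ⊕ G₂) (a , b) → Σ Comp λ j → Step G₁ G₂ j (a , b) q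
  option⇒Step {a} {b} _ q∈ with ∈-++⁻ (map (λ a′ → (a′ , b)) (opts G₁ a)) q∈
  ... | inj₁ m with ∈-map⁻ _ m
  ...   | _ , a′∈ , refl = one , a′∈ , refl
  option⇒Step _ _ | inj₂ m with ∈-map⁻ _ m
  ...   | _ , b′∈ , refl = two , refl , b′∈

  mutual
    ≡-nimbers⇒L : ∀ {a b} → Acc (IsOption (G₁ ⊕ G₂)) (a , b) →
                  nimber G₁ a ≡ nimber G₂ b → outcome (G₁ ⊕ G₂) (a , b) ≡ L
    ≡-nimbers⇒L {a} {b} (acc rs) eq = outcome-L (G₁ ⊕ G₂) λ {q} q∈ → options-W q q∈ (option⇒Step q q∈)
      where
      options-W : ∀ q → q ∈ opts (G₁ ⊕ G₂) (a , b) → Σ Comp (λ j → Step G₁ G₂ j (a , b) q) →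
                  outcome (G₁ ⊕ G₂) q ≡ W
      options-W _ q∈ (one , a′∈ , refl) = ≢-nimbers⇒W (rs q∈) λ eq′ → nimber-option-≢ G₁ a′∈ (trans eq′ (sym eq))
      options-W _ q∈ (two , refl , b′∈) = ≢-nimbers⇒W (rs q∈) λ eq′ → nimber-option-≢ G₂ b′∈ (trans (sym eq′) eq)

    ≢-nimbers⇒W : ∀ {a b} → Acc (IsOption (G₁ ⊕ G₂)) (a , b) →
                  nimber G₁ a ≢ nimber G₂ b → outcome (G₁ ⊕ G₂) (a , b) ≡ W
    ≢-nimbers⇒W {a} {b} (acc rs) ≢ with <-cmp (nimber G₁ a) (nimber G₂ b)
    ... | tri≈ _ eq _ = ⊥-elim (≢ eq)
    ... | tri< lt _ _ with nimber-below G₂ lt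
    ...   | _ , b′∈ , eq = outcome-W (G₁ ⊕ G₂) (move₂ b′∈) (≡-nimbers⇒L (rs (move₂ b′∈)) (sym eq))
    ≢-nimbers⇒W (acc rs) ≢ | tri> _ _ gt with nimber-below G₁ gt
    ...   | _ , a′∈ , eq = outcome-W (G₁ ⊕ G₂) (move₁ a′∈) (≡-nimbers⇒L (rs (move₁ a′∈)) eq)

  outcome-L⇒≡-nimbers : ∀ {a b} → outcome (G₁ ⊕ G₂) (a , b) ≡ L → nimber G₁ a ≡ nimber G₂ b
  outcome-L⇒≡-nimbers {a} {b} isL with nimber G₁ a ≟ nimber G₂ b
  ... | yes eq = eq
  ... | no  ≢  with trans (sym isL) (≢-nimbers⇒W (wf (G₁ ⊕ G₂) _) ≢)
  ...   | ()

  outcome-W⇒≢-nimbers : ∀ {a b} → outcome (G₁ ⊕ G₂) (a , b) ≡ W → nimber G₁ a ≢ nimber G₂ b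
  outcome-W⇒≢-nimbers isW eq with trans (sym isW) (≡-nimbers⇒L (wf (G₁ ⊕ G₂) _) eq)
  ... | ()

other : Comp → Comp
other one = two
other two = one

-- At an L node, the F-values of the component-1 children either name
-- g(P₂) (inj₁) or, so far, list nimbers of options of P₁ (inj₂).
gather : Comp × ℕ → ℕ ⊎ List ℕ → ℕ ⊎ List ℕ
gather (two , m) _         = inj₁ m
gather (one , m) (inj₁ k)  = inj₁ k
gather (one , m) (inj₂ xs) = inj₂ (m ∷ xs)

conclude : ℕ ⊎ List ℕ → Comp × ℕ
conclude (inj₁ m)  = two , m
conclude (inj₂ xs) = one , mex xs

mutual
  F : LTree → Comp × ℕ
  F (lnode W cs) = winningReply cs
  F (lnode L cs) = conclude (evidence cs)

  -- The empty case is junk: a W node of a solution tree has an L child.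
  winningReply : List (Comp × LTree) → Comp × ℕ
  winningReply []                        = one , 0
  winningReply ((j , t@(lnode L _)) ∷ _) = other j , proj₂ (F t)
  winningReply ((_ , lnode W _) ∷ cs)    = winningReply cs

  evidence : List (Comp × LTree) → ℕ ⊎ List ℕ
  evidence []               = inj₂ []
  evidence ((one , t) ∷ cs) = gather (F t) (evidence cs)
  evidence ((two , _) ∷ cs) = evidence cs

module Soundness (G₁ G₂ : Game) where

  Sound : Pos G₁ × Pos G₂ → Comp × ℕ → Set
  Sound p r = nimberAt G₁ G₂ (proj₁ r) (proj₁ p) (proj₂ p) ≡ proj₂ r

  ValidChild : Pos G₁ × Pos G₂ → Comp × SumTree G₁ G₂ → Set
  ValidChild p c = Step G₁ G₂ (proj₁ c) p (rootPos G₁ G₂ (proj₂ c)) × IsSolutionTree G₁ G₂ (proj₂ c)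

  EvidenceSound : Pos G₁ → Pos G₂ → List (Comp × SumTree G₁ G₂) → ℕ ⊎ List ℕ → Set
  EvidenceSound a b cs (inj₁ m)  = nimber G₂ b ≡ m
  EvidenceSound a b cs (inj₂ xs) = xs ⊆ map (nimber G₁) (opts G₁ a)
                                 × (∀ {a′} → (a′ , b) ∈ childPositions G₁ G₂ cs → nimber G₁ a′ ∈ xs)

  nimberAt-agree : ∀ {a b} i {m} → nimber G₁ a ≡ nimber G₂ b → nimberAt G₁ G₂ i a b ≡ m →
                   nimber G₁ a ≡ m × nimber G₂ b ≡ m
  nimberAt-agree one eq g₁≡m = g₁≡m , trans (sym eq) g₁≡m
  nimberAt-agree two eq g₂≡m = trans eq g₂≡m , g₂≡m

  reply-sound : ∀ {a b a′ b′} j r → Step G₁ G₂ j (a , b) (a′ , b′) →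
                nimber G₁ a′ ≡ nimber G₂ b′ → Sound (a′ , b′) r → Sound (a , b) (other j , proj₂ r)
  reply-sound one (i , _) (_ , refl) eq s = proj₂ (nimberAt-agree i eq s)
  reply-sound two (i , _) (refl , _) eq s = proj₁ (nimberAt-agree i eq s)

  mutual
    F-sound : ∀ T → IsSolutionTree G₁ G₂ T → Sound (rootPos G₁ G₂ T) (F (D G₁ G₂ T))
    F-sound (node _ W cs) (sol _ valid _ hasL)    = winningReply-sound cs valid (hasL refl)
    F-sound (node _ L cs) (sol _ valid allOpts _) = L-sound cs valid (proj₂ (allOpts refl))

    winningReply-sound : ∀ {p} cs → All (ValidChild p) cs → Any (λ c → rootLabel G₁ G₂ (proj₂ c) ≡ L) cs →
                         Sound p (winningReply (Dchildren G₁ G₂ cs))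
    winningReply-sound ((_ , node _ W _) ∷ cs) (_ ∷ valid) (there hasL) = winningReply-sound cs valid hasL
    winningReply-sound ((j , t@(node _ L _)) ∷ _) ((step , t-sol@(sol isL _ _ _)) ∷ _) _ =
      reply-sound j (F (D G₁ G₂ t)) step (outcome-L⇒≡-nimbers G₁ G₂ (sym isL)) (F-sound t t-sol)

    evidence-sound : ∀ {a b} cs → All (ValidChild (a , b)) cs →
                     EvidenceSound a b cs (evidence (Dchildren G₁ G₂ cs))
    evidence-sound [] [] = (λ ()) , (λ ())
    evidence-sound ((two , node _ _ _) ∷ cs) (((refl , b∈) , _) ∷ valid)
      with evidence (Dchildren G₁ G₂ cs) | evidence-sound cs valid
    ... | inj₁ _  | g₂≡m          = g₂≡m
    ... | inj₂ _  | xs⊆ , covered = xs⊆ , λ { (here refl) → ⊥-elim (option-irrefl G₂ b∈) ; (there c∈) → covered c∈ }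
    evidence-sound ((one , t@(node _ _ _)) ∷ cs) (((a′∈ , refl) , t-sol) ∷ valid)
      with F (D G₁ G₂ t) | F-sound t t-sol | evidence (Dchildren G₁ G₂ cs) | evidence-sound cs valid
    ... | two , _ | g₂≡m  | _       | _             = g₂≡m
    ... | one , _ | _     | inj₁ _  | g₂≡k          = g₂≡k
    ... | one , _ | g₁≡m  | inj₂ _  | xs⊆ , covered =
      (λ { (here refl) → subst (_∈ _) g₁≡m (∈-map⁺ (nimber G₁) a′∈) ; (there x∈) → xs⊆ x∈ }) ,
      (λ { (here refl) → here g₁≡m ; (there c∈) → there (covered c∈) })

    L-sound : ∀ {a b} cs → All (ValidChild (a , b)) cs →
              (∀ q → q ∈ opts (G₁ ⊕ G₂) (a , b) → q ∈ childPositions G₁ G₂ cs) →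
              Sound (a , b) (conclude (evidence (Dchildren G₁ G₂ cs)))
    L-sound {a} cs valid allOpts with evidence (Dchildren G₁ G₂ cs) | evidence-sound cs valid
    ... | inj₁ _  | g₂≡m          = g₂≡m
    ... | inj₂ xs | xs⊆ , covered = begin
      nimber G₁ a                           ≡⟨ nimber-unfold G₁ a ⟩
      mex (map (nimber G₁) (opts G₁ a))     ≡⟨ mex-cong options⊆ xs⊆ ⟩
      mex xs                                ∎
      where
      options⊆ : map (nimber G₁) (opts G₁ a) ⊆ xs
      options⊆ x∈ with ∈-map⁻ (nimber G₁) x∈
      ... | _ , a′∈ , refl = covered (allOpts _ (move₁ G₁ G₂ a′∈))

open Soundness using (F-sound)

mainTheorem1 : Σ (LTree → Comp × ℕ) λ F →
    (G₁ G₂ : Game) (p₁ : Pos G₁) (p₂ : Pos G₂) (T : SumTree G₁ G₂) →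
    IsSolutionTree G₁ G₂ T → rootPos G₁ G₂ T ≡ (p₁ , p₂) →
    (nimberAt G₁ G₂ (proj₁ (F (D G₁ G₂ T))) p₁ p₂ ≡ proj₂ (F (D G₁ G₂ T)))
    × (lrootLabel (D G₁ G₂ T) ≡ L → nimber G₁ p₁ ≡ nimber G₂ p₂)
    × (lrootLabel (D G₁ G₂ T) ≡ W → nimber G₁ p₁ ≢ nimber G₂ p₂)
mainTheorem1 = F , λ where
  G₁ G₂ _ _ T@(node _ _ _) T-sol@(sol isOutcome _ _ _) refl →
    F-sound G₁ G₂ T T-sol ,
    (λ { refl → outcome-L⇒≡-nimbers G₁ G₂ (sym isOutcome) }) ,
    (λ { refl → outcome-W⇒≢-nimbers G₁ G₂ (sym isOutcome) })
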